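{- Let $G$ be a finite simple graph and let $H$ be an induced subgraph of $G$ whose vertex set $V_H$ is a stable block of $G$. Assume that $G[\mathrm{int}(V_H)]$ has at least one edge. Then $\sigma(G)\le\sigma(G[\mathrm{int}(V_H)])$.
   Context: $G[S]$ denotes the induced subgraph on $S$, $\Delta$ maximum degree, $\alpha$ independence number. For a graph $G=(V,E)$ with at least one edge, $\sigma(G)=\min\{\Delta(G[S]): S\subseteq V,\ |S|>\alpha(G)\}$. For a nonempty proper subset $S\subsetneq V$, the border $\mathrm{bord}(S)$ is the set of vertices of $S$ adjacent to at least one vertex of $V\setminus S$, the interior is $\mathrm{int}(S)=S\setminus\mathrm{bord}(S)$, and $S$ is a stable block if $\alpha(G[S])=\alpha(G[\mathrm{int}(S)])$. -}

module Defs where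

open import Data.Bool using (Bool; true; false; _∧_; not)
open import Data.Nat using (ℕ; _⊔_; _≤_; _<_)
open import Data.Fin using (Fin)
open import Data.Fin.Subset using (Subset; _∈_; _∉_; _⊆_; _∩_; ∣_∣; ⊤; Nonempty)
open import Data.Vec using (lookup; tabulate)
open import Data.List using (foldr; map; allFin)
open import Data.Bool.ListAction using (any)
open import Data.Product using (Σ; _×_; ∃)
open import Relation.Binary.PropositionalEquality using (_≡_)
open import Relation.Nullary using (¬_)

record Graph (n : ℕ) : Set where
  field
    adj   : Fin n → Fin n → Bool
    sym   : ∀ u v → adj u v ≡ adj v u
    irrefl : ∀ v → adj v v ≡ false
open Graph public

module _ {n : ℕ} (G : Graph n) where

  nbhd : Fin n → Subset n
  nbhd v = tabulate (adj G v)

  degIn : Subset n → Fin n → ℕ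
  degIn T v = ∣ T ∩ nbhd v ∣

  maxDeg : Subset n → ℕ
  maxDeg T = foldr _⊔_ 0
    (map (λ v → if′ lookup T v then degIn T v else 0) (allFin n))
    where
      if′_then_else_ : Bool → ℕ → ℕ → ℕ
      if′ true then a else b = a
      if′ false then a else b = b

  Independent : Subset n → Set
  Independent T = ∀ u v → u ∈ T → v ∈ T → adj G u v ≡ false

  HasEdge : Subset n → Set
  HasEdge W = Σ (Fin n) λ u → Σ (Fin n) λ v → u ∈ W × v ∈ W × adj G u v ≡ true

  IsIndepNumber : Subset n → ℕ → Set
  IsIndepNumber W a =
    (Σ (Subset n) λ T → T ⊆ W × Independent T × ∣ T ∣ ≡ a)
    × (∀ T → T ⊆ W → Independent T → ∣ T ∣ ≤ a)

  IsSigma : Subset n → ℕ → Set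
  IsSigma W s = Σ ℕ λ a → IsIndepNumber W a ×
    ((Σ (Subset n) λ T → T ⊆ W × a < ∣ T ∣ × maxDeg T ≡ s)
     × (∀ T → T ⊆ W → a < ∣ T ∣ → s ≤ maxDeg T))

  bord : Subset n → Subset n
  bord S = tabulate λ v →
    lookup S v ∧ any (λ u → not (lookup S u) ∧ adj G v u) (allFin n)

  int : Subset n → Subset n
  int S = tabulate λ v → lookup S v ∧ not (lookup (bord S) v)

  StableBlock : Subset n → Set
  StableBlock S = Nonempty S × (∃ λ v → v ∉ S) ×
    (Σ ℕ λ a → IsIndepNumber S a × IsIndepNumber (int S) a)

-- Take a maximum independent set I of G and a set T ⊆ int(V_H) with
-- |T| > α(G[int V_H]) and Δ(G[T]) = σ(G[int V_H]).  Interior vertices have no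
-- neighbours outside V_H, so adding the independent set X = I ∖ V_H to T creates
-- no new edges: Δ(G[T ∪ X]) = Δ(G[T]).  Since I ∩ V_H is independent in G[V_H],
-- |I ∩ V_H| ≤ α(G[V_H]) = α(G[int V_H]) < |T|, whence |T ∪ X| > |I| = α(G), and
-- therefore σ(G) ≤ Δ(G[T ∪ X]) = σ(G[int V_H]).
module Submission where

open import Defs hiding (sym)
open import Data.Bool using (Bool; T; true; false; not; _∧_)
open import Data.Bool.Properties using (T-≡; ∧-zeroʳ)
open import Data.Nat using (ℕ; suc; _≤_; _<_; _+_; _⊔_; z≤n)
open import Data.Nat.Properties
  using (≤-trans; ≤-antisym; +-suc; +-monoˡ-≤; +-monoˡ-<; m≤m⊔n; m≤n⊔m; ⊔-lub; ⊔-identityʳ;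
         n≤0⇒n≡0; module ≤-Reasoning)
open import Data.Fin using (Fin)
open import Data.Fin.Subset using (Subset; ⊤; ⊥; _∈_; _∉_; _⊆_; _∩_; _∪_; ∁; ∣_∣; inside; outside)
open import Data.Fin.Subset.Properties
  using (⊆⊤; ∣⊥∣≡0; p⊆q⇒∣p∣≤∣q∣; p∩q⊆p; p∩q⊆q; x∈p∩q⁺; x∈p∩q⁻; x∈p∪q⁻; ∪-comm; x∈∁p⇒x∉p)
open import Data.Vec using ([]; _∷_; lookup; tabulate) renaming (here to hereᵥ; there to thereᵥ)
open import Data.Vec.Properties using (lookup∘tabulate; []=⇒lookup; lookup⇒[]=)
open import Data.List as List using (List; foldr; map; allFin)
open import Data.List.Relation.Unary.Any using (here; there)
open import Data.List.Relation.Unary.Any.Properties using (any⁺)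
open import Data.List.Membership.Propositional using (lose) renaming (_∈_ to _∈ₗ_)
open import Data.List.Membership.Propositional.Properties using (∈-allFin)
open import Data.Product using (_×_; _,_)
open import Data.Sum using (inj₁; inj₂)
open import Function.Bundles using (Equivalence)
open import Relation.Nullary using (contradiction)
open import Relation.Binary.PropositionalEquality
  using (_≡_; refl; sym; trans; cong; cong₂; subst)

foldr-⊔-lub : ∀ {a} {A : Set a} {f : A → ℕ} {t} (xs : List A) →
              (∀ x → f x ≤ t) → foldr _⊔_ 0 (map f xs) ≤ t
foldr-⊔-lub List.[]       f≤t = z≤n
foldr-⊔-lub (x List.∷ xs) f≤t = ⊔-lub (f≤t x) (foldr-⊔-lub xs f≤t)

≤-foldr-⊔ : ∀ {a} {A : Set a} {f : A → ℕ} {x} {xs : List A} →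
            x ∈ₗ xs → f x ≤ foldr _⊔_ 0 (map f xs)
≤-foldr-⊔ (here refl)  = m≤m⊔n _ _
≤-foldr-⊔ (there x∈xs) = ≤-trans (≤-foldr-⊔ x∈xs) (m≤n⊔m _ _)

∣p∣≡∣p∩q∣+∣p∩∁q∣ : ∀ {n} (p q : Subset n) → ∣ p ∣ ≡ ∣ p ∩ q ∣ + ∣ p ∩ ∁ q ∣
∣p∣≡∣p∩q∣+∣p∩∁q∣ []            []            = refl
∣p∣≡∣p∩q∣+∣p∩∁q∣ (inside  ∷ p) (inside  ∷ q) = cong suc (∣p∣≡∣p∩q∣+∣p∩∁q∣ p q)
∣p∣≡∣p∩q∣+∣p∩∁q∣ (inside  ∷ p) (outside ∷ q) =
  trans (cong suc (∣p∣≡∣p∩q∣+∣p∩∁q∣ p q)) (sym (+-suc _ _))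
∣p∣≡∣p∩q∣+∣p∩∁q∣ (outside ∷ p) (_       ∷ q) = ∣p∣≡∣p∩q∣+∣p∩∁q∣ p q

∣p∪q∣≡∣p∣+∣q∣ : ∀ {n} (p q : Subset n) → (∀ {x} → x ∈ p → x ∉ q) → ∣ p ∪ q ∣ ≡ ∣ p ∣ + ∣ q ∣
∣p∪q∣≡∣p∣+∣q∣ []            []            _     = refl
∣p∪q∣≡∣p∣+∣q∣ (inside  ∷ p) (inside  ∷ q) disj  = contradiction hereᵥ (disj hereᵥ)
∣p∪q∣≡∣p∣+∣q∣ (inside  ∷ p) (outside ∷ q) disj  =
  cong suc (∣p∪q∣≡∣p∣+∣q∣ p q λ x∈p x∈q → disj (thereᵥ x∈p) (thereᵥ x∈q))
∣p∪q∣≡∣p∣+∣q∣ (outside ∷ p) (inside  ∷ q) disj  =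
  trans (cong suc (∣p∪q∣≡∣p∣+∣q∣ p q λ x∈p x∈q → disj (thereᵥ x∈p) (thereᵥ x∈q))) (sym (+-suc _ _))
∣p∪q∣≡∣p∣+∣q∣ (outside ∷ p) (outside ∷ q) disj  =
  ∣p∪q∣≡∣p∣+∣q∣ p q λ x∈p x∈q → disj (thereᵥ x∈p) (thereᵥ x∈q)

∈-tabulate⁻ : ∀ {n} {f : Fin n → Bool} {x} → x ∈ tabulate f → f x ≡ true
∈-tabulate⁻ {f = f} {x} x∈ = trans (sym (lookup∘tabulate f x)) ([]=⇒lookup x∈)

∈-tabulate⁺ : ∀ {n} {f : Fin n → Bool} {x} → f x ≡ true → x ∈ tabulate f
∈-tabulate⁺ {f = f} {x} fx = lookup⇒[]= x (tabulate f) (trans (lookup∘tabulate f x) fx)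

lookup-∉ : ∀ {n} {p : Subset n} {x} → x ∉ p → lookup p x ≡ false
lookup-∉ {p = p} {x} x∉p with lookup p x in eq
... | false = refl
... | true  = contradiction (lookup⇒[]= x p eq) x∉p

module _ {n : ℕ} (G : Graph n) where

  Separated : Subset n → Subset n → Set
  Separated A B = ∀ u v → u ∈ A → v ∈ B → adj G u v ≡ false

  separated-⊆ : ∀ {A A′ B B′} → A′ ⊆ A → B′ ⊆ B → Separated A B → Separated A′ B′
  separated-⊆ A′⊆A B′⊆B sep u v u∈A′ v∈B′ = sep u v (A′⊆A u∈A′) (B′⊆B v∈B′)

  -- Defs keeps the summand of maxDeg local; unification recovers it here.
  summandOf : {f : Fin n → ℕ} {m : ℕ} → foldr _⊔_ 0 (map f (allFin n)) ≡ m → Fin n → ℕ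
  summandOf {f} _ = f

  maxDegSummand : Subset n → Fin n → ℕ
  maxDegSummand T = summandOf (refl {x = maxDeg G T})

  maxDegSummand-∈ : ∀ {T v} → v ∈ T → maxDegSummand T v ≡ degIn G T v
  maxDegSummand-∈ {T} {v} v∈T with lookup T v | []=⇒lookup v∈T
  ... | true | refl = refl

  degIn≤maxDeg : ∀ {T v} → v ∈ T → degIn G T v ≤ maxDeg G T
  degIn≤maxDeg {T} {v} v∈T =
    subst (_≤ maxDeg G T) (maxDegSummand-∈ v∈T) (≤-foldr-⊔ {f = maxDegSummand T} (∈-allFin v))

  maxDeg-lub : ∀ {T t} → (∀ {v} → v ∈ T → degIn G T v ≤ t) → maxDeg G T ≤ t
  maxDeg-lub {T} {t} deg≤t = foldr-⊔-lub (allFin n) bound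
    where
    bound : ∀ v → maxDegSummand T v ≤ t
    bound v with lookup T v in eq
    ... | true  = deg≤t (lookup⇒[]= v T eq)
    ... | false = z≤n

  degIn-mono : ∀ {A B v} → (∀ {u} → u ∈ A → adj G v u ≡ true → u ∈ B) → degIn G A v ≤ degIn G B v
  degIn-mono {A} {B} {v} nbhd⊆ = p⊆q⇒∣p∣≤∣q∣ λ u∈ → restrict (x∈p∩q⁻ A (nbhd G v) u∈)
    where
    restrict : ∀ {u} → u ∈ A × u ∈ nbhd G v → u ∈ B ∩ nbhd G v
    restrict (u∈A , u∈N) = x∈p∩q⁺ (nbhd⊆ u∈A (∈-tabulate⁻ u∈N) , u∈N)

  degIn-∪-isolated : ∀ {A B v} → (∀ {u} → u ∈ B → adj G v u ≡ false) → degIn G (A ∪ B) v ≤ degIn G A v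
  degIn-∪-isolated {A} {B} {v} isolated = degIn-mono nbhd⊆A
    where
    nbhd⊆A : ∀ {u} → u ∈ A ∪ B → adj G v u ≡ true → u ∈ A
    nbhd⊆A {u} u∈A∪B vu with x∈p∪q⁻ A B u∈A∪B
    ... | inj₁ u∈A = u∈A
    ... | inj₂ u∈B = contradiction (trans (sym vu) (isolated u∈B)) λ ()

  maxDeg-∪ : ∀ {A B} → Separated A B → maxDeg G (A ∪ B) ≤ maxDeg G A ⊔ maxDeg G B
  maxDeg-∪ {A} {B} sep = maxDeg-lub bound
    where
    bound : ∀ {v} → v ∈ A ∪ B → degIn G (A ∪ B) v ≤ maxDeg G A ⊔ maxDeg G B
    bound {v} v∈A∪B with x∈p∪q⁻ A B v∈A∪B
    ... | inj₁ v∈A = begin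
      degIn G (A ∪ B) v  ≤⟨ degIn-∪-isolated {A} {B} (sep v _ v∈A) ⟩
      degIn G A v        ≤⟨ degIn≤maxDeg v∈A ⟩
      maxDeg G A         ≤⟨ m≤m⊔n _ _ ⟩
      maxDeg G A ⊔ maxDeg G B ∎
      where open ≤-Reasoning
    ... | inj₂ v∈B = begin
      degIn G (A ∪ B) v  ≡⟨ cong (λ C → degIn G C v) (∪-comm A B) ⟩
      degIn G (B ∪ A) v  ≤⟨ degIn-∪-isolated {B} {A} (λ u∈A → trans (Graph.sym G v _) (sep _ v u∈A v∈B)) ⟩
      degIn G B v        ≤⟨ degIn≤maxDeg v∈B ⟩
      maxDeg G B         ≤⟨ m≤n⊔m _ _ ⟩
      maxDeg G A ⊔ maxDeg G B ∎
      where open ≤-Reasoning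

  maxDeg-independent : ∀ {X} → Independent G X → maxDeg G X ≡ 0
  maxDeg-independent {X} indep = n≤0⇒n≡0 (maxDeg-lub λ {v} v∈X → begin
    degIn G X v  ≤⟨ degIn-mono {B = ⊥} (λ u∈X vu → contradiction (trans (sym vu) (indep v _ v∈X u∈X)) λ ()) ⟩
    degIn G ⊥ v  ≤⟨ p⊆q⇒∣p∣≤∣q∣ (p∩q⊆p ⊥ (nbhd G v)) ⟩
    ∣ ⊥ {n} ∣    ≡⟨ ∣⊥∣≡0 n ⟩
    0            ∎)
    where open ≤-Reasoning

  int⊆ : ∀ S → int G S ⊆ S
  int⊆ S {v} v∈int with lookup S v in eq | ∈-tabulate⁻ v∈int
  ... | true  | _  = lookup⇒[]= v S eq
  ... | false | ()

  ∈int⇒∉bord : ∀ {S v} → v ∈ int G S → v ∉ bord G S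
  ∈int⇒∉bord {S} {v} v∈int v∈bord =
    contradiction (trans (sym (∈-tabulate⁻ v∈int))
                         (trans (cong (λ b → lookup S v ∧ not b) ([]=⇒lookup v∈bord)) (∧-zeroʳ _)))
                  λ ()

  ∈-bord : ∀ {S v u} → v ∈ S → u ∉ S → adj G v u ≡ true → v ∈ bord G S
  ∈-bord {S} {v} {u} v∈S u∉S vu =
    ∈-tabulate⁺ (cong₂ _∧_ ([]=⇒lookup v∈S) (Equivalence.to T-≡ (any⁺ _ (lose (∈-allFin u) edge-out))))
    where
    edge-out : T (not (lookup S u) ∧ adj G v u)
    edge-out = Equivalence.from T-≡ (cong₂ (λ b c → not b ∧ c) (lookup-∉ u∉S) vu)

  int-separated : ∀ S → Separated (int G S) (∁ S)
  int-separated S v u v∈int u∈∁S with adj G v u in vu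
  ... | false = refl
  ... | true  = contradiction (∈-bord (int⊆ S v∈int) (x∈∁p⇒x∉p u∈∁S) vu) (∈int⇒∉bord {S} v∈int)

  maxDeg-∪-outside : ∀ {S T I} → T ⊆ int G S → Independent G I → maxDeg G (T ∪ (I ∩ ∁ S)) ≤ maxDeg G T
  maxDeg-∪-outside {S} {T} {I} T⊆int I-indep = begin
    maxDeg G (T ∪ X)         ≤⟨ maxDeg-∪ (separated-⊆ T⊆int (p∩q⊆q I (∁ S)) (int-separated S)) ⟩
    maxDeg G T ⊔ maxDeg G X  ≡⟨ cong (maxDeg G T ⊔_) (maxDeg-independent X-indep) ⟩
    maxDeg G T ⊔ 0           ≡⟨ ⊔-identityʳ _ ⟩
    maxDeg G T               ∎
    where
    open ≤-Reasoning
    X = I ∩ ∁ S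
    X-indep : Independent G X
    X-indep = separated-⊆ (p∩q⊆p I (∁ S)) (p∩q⊆p I (∁ S)) I-indep

  ∣∪-outside∣ : ∀ {S T} I → T ⊆ int G S → ∣ T ∪ (I ∩ ∁ S) ∣ ≡ ∣ T ∣ + ∣ I ∩ ∁ S ∣
  ∣∪-outside∣ {S} {T} I T⊆int = ∣p∪q∣≡∣p∣+∣q∣ T (I ∩ ∁ S) λ x∈T x∈X →
    x∈∁p⇒x∉p (p∩q⊆q I (∁ S) x∈X) (int⊆ S (T⊆int x∈T))

  indepNumber-unique : ∀ {W a b} → IsIndepNumber G W a → IsIndepNumber G W b → a ≡ b
  indepNumber-unique ((I , I⊆W , I-indep , ∣I∣≡a) , a-max) ((J , J⊆W , J-indep , ∣J∣≡b) , b-max) =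
    ≤-antisym (subst (_≤ _) ∣I∣≡a (b-max I I⊆W I-indep)) (subst (_≤ _) ∣J∣≡b (a-max J J⊆W J-indep))

proposition4p2 : ∀ {n : ℕ} (G : Graph n) (VH : Subset n) →
    StableBlock G VH → HasEdge G (int G VH) →
    ∀ (s t : ℕ) → IsSigma G ⊤ s → IsSigma G (int G VH) t → s ≤ t
-- The edge hypothesis only guarantees that σ(G[int V_H]) exists, which IsSigma already provides.
proposition4p2 G S (_ , _ , b , (_ , α-bound) , α-int) _ s t
  (a , ((I , _ , I-indep , ∣I∣≡a) , _) , _ , σ-minimal)
  (a′ , α-int′ , (T , T⊆int , a′<∣T∣ , ΔT≡t) , _) = begin
    s                 ≤⟨ σ-minimal (T ∪ X) ⊆⊤ a<∣T∪X∣ ⟩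
    maxDeg G (T ∪ X)  ≤⟨ maxDeg-∪-outside G T⊆int I-indep ⟩
    maxDeg G T        ≡⟨ ΔT≡t ⟩
    t                 ∎
  where
  open ≤-Reasoning
  X = I ∩ ∁ S
  a<∣T∪X∣ : a < ∣ T ∪ X ∣
  a<∣T∪X∣ = begin-strict
    a                  ≡⟨ sym ∣I∣≡a ⟩
    ∣ I ∣              ≡⟨ ∣p∣≡∣p∩q∣+∣p∩∁q∣ I S ⟩
    ∣ I ∩ S ∣ + ∣ X ∣  ≤⟨ +-monoˡ-≤ ∣ X ∣ (α-bound (I ∩ S) (p∩q⊆q I S)
                                       (separated-⊆ G (p∩q⊆p I S) (p∩q⊆p I S) I-indep)) ⟩
    b + ∣ X ∣          ≡⟨ cong (_+ ∣ X ∣) (indepNumber-unique G α-int α-int′) ⟩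
    a′ + ∣ X ∣         <⟨ +-monoˡ-< ∣ X ∣ a′<∣T∣ ⟩
    ∣ T ∣ + ∣ X ∣      ≡⟨ sym (∣∪-outside∣ G I T⊆int) ⟩
    ∣ T ∪ X ∣          ∎
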